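{- Let $k\ge 2$ be an integer and $q$ a prime power, and let $\Gamma=[l^{(1)}],\langle r^{(1)}\rangle,[l^{(2)}],\langle r^{(2)}\rangle,\dots$ be a backtrackless walk in $\Lambda_{k,q}$ with $[l^{(1)}]=(0,0,\dots,0)\in L_k$ and $\langle r^{(1)}\rangle=(0,0,\dots,0)\in R_k$. Write $x_i=l^{(i)}_0$, $y_i=r^{(i)}_0$, $u_i=x_{i+1}-x_i$, $v_i=y_{i+1}-y_i$. Then for every $i\ge 1$ such that $[l^{(i+1)}]$ and $\langle r^{(i+1)}\rangle$ lie on $\Gamma$, and every $j\ge 0$ (with the coordinate index on the left-hand side at most $k$), $$l^{(i+1)}_{4j}=\rho_{i-j-1}(u_1,v_1,\dots,u_{i-1},v_{i-1},u_i),$$ $$l^{(i+1)}_{4j+1}=\rho_{i-j-2}(v_1,u_2,\dots,v_{i-1},u_i),$$ $$l^{(i+1)}_{4j+2}=y_{i+1}\,l^{(i+1)}_{4j}-\rho_{i-j-1}(u_1,v_1,\dots,u_i,v_i),$$ $$l^{(i+1)}_{4j+3}=y_{i+1}\,l^{(i+1)}_{4j+1}-\rho_{i-j-2}(v_1,u_2,\dots,v_{i-1},u_i,v_i).$$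
   Context: For a prime power $q$ and integer $k\ge2$, $\Lambda_{k,q}$ is the bipartite graph with vertex set $L_k\cup R_k$ (regarded as disjoint), where $L_k$ is the set of vectors $[l]=(l_0,l_1,\dots,l_k)\in\mathbb{F}_q^{k+1}$ with $l_1=l_2$ and $R_k$ is the set of vectors $\langle r\rangle=(r_0,r_1,\dots,r_k)\in\mathbb{F}_q^{k+1}$ with $r_1=0$; edges join only $L_k$ to $R_k$, and $[l]\sim\langle r\rangle$ iff for every $2\le i\le k$: $l_i+r_i=r_0l_{i-2}$ if $i\equiv 2,3\pmod 4$, and $l_i+r_i=l_0r_{i-2}$ if $i\equiv 0,1\pmod 4$. A backtrackless walk is a sequence of vertices $w_1,w_2,\dots$ with $w_i\sim w_{i+1}$ and $w_j\neq w_{j+2}$ for all relevant indices; $l^{(i)}_j$, $r^{(i)}_j$ denote the $(j+1)$-th coordinates of $[l^{(i)}]$, $\langle r^{(i)}\rangle$. For $\omega_1,\dots,\omega_n$ in $\mathbb{F}_q$: $\rho_0(\omega_1,\dots,\omega_n)=\omega_1\cdots\omega_n$; for $1\le s\le\lfloor n/2\rfloor$, $\rho_s(\omega_1,\dots,\omega_n)=\sum_{1\le i_1<\dots<i_s\le n-s}\prod_{j=1}^n\omega_j\big/\prod_{j=1}^s\omega_{i_j+j-1}\omega_{i_j+j}$, i.e. the sum, over all ways of deleting $s$ disjoint pairs of consecutive terms from the sequence, of the product of the remaining terms; $\rho_s(\omega_1,\dots,\omega_n)=0$ if $n<2s$ or $s<0$; for the empty sequence, $\rho_0=1$ and $\rho_s=0$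 for $s\ne0$. -}

module Defs where

open import Level using (Level)
open import Algebra.Bundles using (CommutativeRing)
open import Data.Nat using (ℕ; zero; suc; _≤_; _<?_; _%_)
import Data.Nat as N
open import Data.Nat.Primality using (Prime)
open import Data.Fin using (Fin; fromℕ<)
open import Data.Integer using (ℤ; +_; -[1+_])
open import Data.List using (List; []; _∷_; _++_; map; foldr)
open import Data.Product using (Σ; _×_; ∃; ∃-syntax)
open import Data.Sum using (_⊎_)
open import Relation.Nullary using (¬_; yes; no)
open import Relation.Binary.PropositionalEquality using (_≡_)
import Relation.Binary.PropositionalEquality as P
open import Function.Bundles using (Bijection)

IsPrimePower : ℕ → Set
IsPrimePower q = ∃[ p ] ∃[ e ] (Prime p × q ≡ p N.^ suc e)

module _ {c ℓ : Level} (R : CommutativeRing c ℓ) where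
  open CommutativeRing R

  IsField : Set (c Level.⊔ ℓ)
  IsField = (¬ (1# ≈ 0#)) × (∀ x → ¬ (x ≈ 0#) → ∃[ y ] (x * y ≈ 1#))

  IsFieldOfOrder : ℕ → Set (c Level.⊔ ℓ)
  IsFieldOfOrder q = IsField × Bijection setoid (P.setoid (Fin q))

  Vect : ℕ → Set c
  Vect k = Fin (suc k) → Carrier

  -- coordinate v_n (only ever used with n ≤ k; defaults to 0 otherwise)
  at : ∀ {k} → Vect k → ℕ → Carrier
  at {k} v n with n <? suc k
  ... | yes n<k+1 = v (fromℕ< n<k+1)
  ... | no  _     = 0#

  InL : ∀ {k} → Vect k → Set ℓ
  InL l = at l 1 ≈ at l 2

  InR : ∀ {k} → Vect k → Set ℓ
  InR r = at r 1 ≈ 0#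

  Adj : ∀ {k} → Vect k → Vect k → Set ℓ
  Adj {k} l r = ∀ (i : ℕ) → 2 ≤ i → i ≤ k →
      ((i % 4 ≡ 2 ⊎ i % 4 ≡ 3) → at l i + at r i ≈ at r 0 * at l (i N.∸ 2))
    × ((i % 4 ≡ 0 ⊎ i % 4 ≡ 1) → at l i + at r i ≈ at l 0 * at r (i N.∸ 2))

  _≉v_ : ∀ {k} → Vect k → Vect k → Set ℓ
  v ≉v w = ¬ (∀ j → v j ≈ w j)

  -- A backtrackless walk [l^(1)], ⟨r^(1)⟩, [l^(2)], ⟨r^(2)⟩, … with m vertices
  -- (w_{2t-1} = [l^(t)], w_{2t} = ⟨r^(t)⟩, t ≥ 1; index 0 of l, r unused).
  record BacktracklessWalk (k m : ℕ) (l r : ℕ → Vect k) : Set (c Level.⊔ ℓ) where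
    field
      l∈L     : ∀ t → 1 ≤ t → 2 N.* t ≤ suc m → InL (l t)
      r∈R     : ∀ t → 1 ≤ t → 2 N.* t ≤ m → InR (r t)
      adj-lr  : ∀ t → 1 ≤ t → 2 N.* t ≤ m → Adj (l t) (r t)
      adj-rl  : ∀ t → 1 ≤ t → 2 N.* t N.+ 1 ≤ m → Adj (l (suc t)) (r t)
      nobt-l  : ∀ t → 1 ≤ t → 2 N.* t N.+ 1 ≤ m → l t ≉v l (suc t)
      nobt-r  : ∀ t → 1 ≤ t → 2 N.* t N.+ 2 ≤ m → r t ≉v r (suc t)

  -- all ways of deleting s disjoint pairs of consecutive terms from a sequence
  deletions : ℕ → List Carrier → List (List Carrier)
  deletions zero    ws               = ws ∷ []
  deletions (suc s) []               = []
  deletions (suc s) (w ∷ [])         = []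
  deletions (suc s) (w ∷ w' ∷ ws)    =
    map (w ∷_) (deletions (suc s) (w' ∷ ws)) ++ deletions s ws

  prod : List Carrier → Carrier
  prod = foldr _*_ 1#

  sumL : List Carrier → Carrier
  sumL = foldr _+_ 0#

  -- ρ_s(ω_1,…,ω_n); ρ_s = 0 for s < 0 (and automatically for n < 2s)
  ρ : ℤ → List Carrier → Carrier
  ρ (+ s)    ws = sumL (map prod (deletions s ws))
  ρ -[1+ _ ] ws = 0#

  -- sequences built from u, v (1-indexed)
  -- uvSeq u v t = u_1, v_1, …, u_t, v_t
  uvSeq : (ℕ → Carrier) → (ℕ → Carrier) → ℕ → List Carrier
  uvSeq u v zero    = []
  uvSeq u v (suc t) = uvSeq u v t ++ (u (suc t) ∷ v (suc t) ∷ [])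

  -- vuSeq u v t = v_1, u_2, …, v_t, u_{t+1}
  vuSeq : (ℕ → Carrier) → (ℕ → Carrier) → ℕ → List Carrier
  vuSeq u v zero    = []
  vuSeq u v (suc t) = vuSeq u v t ++ (v (suc t) ∷ u (suc (suc t)) ∷ [])

{-# OPTIONS --safe #-}
-- Subtracting the adjacency equations of two consecutive vertices with their common
-- neighbour shows that one step of the walk changes a coordinate by a single product:
-- l⁽ᵗ⁺¹⁾ₙ = l⁽ᵗ⁾ₙ + uₜ r⁽ᵗ⁾ₙ₋₂ for n ≡ 0, 1 (mod 4), l⁽ᵗ⁺¹⁾₁ = l⁽ᵗ⁾₁ + uₜ yₜ (as l₁ = l₂),
-- and r⁽ᵗ⁺¹⁾ₙ = r⁽ᵗ⁾ₙ + vₜ l⁽ᵗ⁺¹⁾ₙ₋₂ for n ≡ 2, 3 (mod 4).  Splitting the deletions of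
-- ω₁,…,ω_{N+2} according to whether the last pair is deleted gives the same recurrence
-- ρ_σ(ω₁,…,ω_{N+2}) = ρ_{σ-1}(ω₁,…,ω_N) + ω_{N+2} ρ_σ(ω₁,…,ω_{N+1}), so the closed forms
-- (for the l- and the r-coordinates together) follow by induction along the walk from
-- the zero vertices.
module Submission where

open import Defs
open import Level using (Level)
open import Algebra.Bundles using (CommutativeRing)
open import Data.Nat using (ℕ; zero; suc; _≤_; _<_; z≤n; s≤s; s≤s⁻¹; _%_)
import Data.Nat as N
import Data.Nat.Properties as ℕₚ
open import Data.Nat.DivMod using ([m+kn]%n≡m%n; m*n%n≡0)
open import Data.Nat.Tactic.RingSolver using (solve-∀)
open import Data.Integer using (+_; -[1+_]; _⊖_; pred)
open import Data.Integer.Properties using ([1+m]⊖[1+n]≡m⊖n; distribʳ-⊖-+-neg)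
open import Data.List using (List; []; _∷_; _++_; map; length)
open import Data.List.Properties using (map-++; ++-assoc; length-++)
open import Data.Product using (_×_; _,_; proj₁; proj₂)
open import Data.Sum using (_⊎_; inj₁; inj₂)
open import Data.Empty using (⊥-elim)
open import Relation.Nullary using (yes; no)
open import Relation.Binary.PropositionalEquality as ≡ using (_≡_; cong)

pred[1+m⊖n]≡m⊖n : ∀ m n → pred (suc m ⊖ n) ≡ m ⊖ n
pred[1+m⊖n]≡m⊖n m n = ≡.trans (distribʳ-⊖-+-neg 0 (suc m) n) ([1+m]⊖[1+n]≡m⊖n m n)

n≡2+n′⇒n≤k⇒n′≤k : ∀ {n n′ k} → n ≡ 2 N.+ n′ → n ≤ k → n′ ≤ k
n≡2+n′⇒n≤k⇒n′≤k {n′ = n′} ≡.refl = ℕₚ.≤-trans (ℕₚ.m≤n+m n′ 2)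

4[1+j]≡2+[4j+2] : ∀ j → 4 N.* suc j ≡ 2 N.+ (4 N.* j N.+ 2)
4[1+j]≡2+[4j+2] = solve-∀

4[1+j]+1≡2+[4j+3] : ∀ j → 4 N.* suc j N.+ 1 ≡ 2 N.+ (4 N.* j N.+ 3)
4[1+j]+1≡2+[4j+3] = solve-∀

4j+2≡2+4j : ∀ j → 4 N.* j N.+ 2 ≡ 2 N.+ 4 N.* j
4j+2≡2+4j j = ℕₚ.+-comm (4 N.* j) 2

4j+3≡2+[4j+1] : ∀ j → 4 N.* j N.+ 3 ≡ 2 N.+ (4 N.* j N.+ 1)
4j+3≡2+[4j+1] = solve-∀

4j%4≡0 : ∀ j → (4 N.* j) % 4 ≡ 0
4j%4≡0 j = ≡.trans (cong (_% 4) (ℕₚ.*-comm 4 j)) (m*n%n≡0 j 4)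

[4j+r]%4≡r%4 : ∀ j r → (4 N.* j N.+ r) % 4 ≡ r % 4
[4j+r]%4≡r%4 j r =
  ≡.trans (cong (_% 4) (≡.trans (ℕₚ.+-comm (4 N.* j) r) (cong (r N.+_) (ℕₚ.*-comm 4 j))))
          ([m+kn]%n≡m%n r j 4)

2[1+t]≡1+[2t+1] : ∀ t → 2 N.* suc t ≡ suc (2 N.* t N.+ 1)
2[1+t]≡1+[2t+1] = solve-∀

module RingLemmas {c ℓ : Level} (R : CommutativeRing c ℓ) where
  open CommutativeRing R
  open import Algebra.Properties.Group +-group using (x≈z//y; //-rightDividesˡ)
  open import Relation.Binary.Reasoning.Setoid setoid
  open import Algebra.Solver.Ring.NaturalCoefficients.Default commutativeSemiring

  x+[y-x]≈y : ∀ x y → x + (y - x) ≈ y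
  x+[y-x]≈y x y = trans (+-comm x (y - x)) (//-rightDividesˡ x y)

  x+z≈p∧y+z≈p′⇒y≈x+[p′-p] : ∀ {x y z p p′} → x + z ≈ p → y + z ≈ p′ → y ≈ x + (p′ - p)
  x+z≈p∧y+z≈p′⇒y≈x+[p′-p] {x} {y} {z} {p} {p′} x+z≈p y+z≈p′ = begin
    y                   ≈⟨ x≈z//y y z p′ y+z≈p′ ⟩
    p′ - z              ≈⟨ +-congʳ (x+[y-x]≈y p p′) ⟨
    p + (p′ - p) - z    ≈⟨ solve 4 (λ p p′ -p -z → p :+ (p′ :+ -p) :+ -z := p :+ -z :+ (p′ :+ -p))
                                 refl p p′ (- p) (- z) ⟩
    (p - z) + (p′ - p)  ≈⟨ +-congʳ (x≈z//y x z p x+z≈p) ⟨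
    x + (p′ - p)        ∎

  same-recurrence : ∀ {p q a a′ b b′} w →
    p ≈ a + w * b → a ≈ a′ → b ≈ b′ → q ≈ a′ + w * b′ → p ≈ q
  same-recurrence w p≈ a≈a′ b≈b′ q≈ = trans p≈ (trans (+-cong a≈a′ (*-congˡ b≈b′)) (sym q≈))

  x≈0∧y≈0⇒x+z*y≈0 : ∀ {x y} z → x ≈ 0# → y ≈ 0# → x + z * y ≈ 0#
  x≈0∧y≈0⇒x+z*y≈0 z x≈0 y≈0 = trans (+-cong x≈0 (trans (*-congˡ y≈0) (zeroʳ z))) (+-identityʳ 0#)

module DeletionSums {c ℓ : Level} (R : CommutativeRing c ℓ) where
  open CommutativeRing R
  open RingLemmas R using (x≈0∧y≈0⇒x+z*y≈0)
  open import Relation.Binary.Reasoning.Setoid setoid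
  open import Algebra.Solver.Ring.NaturalCoefficients.Default commutativeSemiring

  sumL-++ : ∀ xs ys → sumL R (xs ++ ys) ≈ sumL R xs + sumL R ys
  sumL-++ []       ys = sym (+-identityˡ _)
  sumL-++ (x ∷ xs) ys = trans (+-congˡ (sumL-++ xs ys)) (sym (+-assoc _ _ _))

  sumL-prod-∷ : ∀ w ds → sumL R (map (prod R) (map (w ∷_) ds)) ≈ w * sumL R (map (prod R) ds)
  sumL-prod-∷ w []       = sym (zeroʳ w)
  sumL-prod-∷ w (d ∷ ds) = trans (+-congˡ (sumL-prod-∷ w ds)) (sym (distribˡ w _ _))

  ρ-front : ∀ σ a b ws → ρ R σ (a ∷ b ∷ ws) ≈ ρ R (pred σ) ws + a * ρ R σ (b ∷ ws)
  ρ-front (+ zero)  a b ws =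
    solve 2 (λ a P → a :* P :+ con 0 := con 0 :+ a :* (P :+ con 0)) refl a (prod R (b ∷ ws))
  ρ-front (+ suc s) a b ws = begin
    sumL R (map (prod R) (map (a ∷_) D₁ ++ D₂))
      ≡⟨ cong (sumL R) (map-++ (prod R) (map (a ∷_) D₁) D₂) ⟩
    sumL R (map (prod R) (map (a ∷_) D₁) ++ map (prod R) D₂)
      ≈⟨ sumL-++ (map (prod R) (map (a ∷_) D₁)) (map (prod R) D₂) ⟩
    sumL R (map (prod R) (map (a ∷_) D₁)) + ρ R (+ s) ws
      ≈⟨ +-congʳ (sumL-prod-∷ a D₁) ⟩
    a * ρ R (+ suc s) (b ∷ ws) + ρ R (+ s) ws
      ≈⟨ +-comm _ _ ⟩
    ρ R (+ s) ws + a * ρ R (+ suc s) (b ∷ ws) ∎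
    where
    D₁ = deletions R (suc s) (b ∷ ws)
    D₂ = deletions R s ws
  ρ-front -[1+ n ]  a b ws = sym (trans (+-identityˡ _) (zeroʳ a))

  ρ-[x] : ∀ σ a → ρ R σ (a ∷ []) ≈ a * ρ R σ []
  ρ-[x] (+ zero)  a = solve 1 (λ a → a :* con 1 :+ con 0 := a :* (con 1 :+ con 0)) refl a
  ρ-[x] (+ suc s) a = sym (zeroʳ a)
  ρ-[x] -[1+ n ]  a = sym (zeroʳ a)

  ρ-back : ∀ σ ws a b → ρ R σ (ws ++ a ∷ b ∷ []) ≈ ρ R (pred σ) ws + b * ρ R σ (ws ++ a ∷ [])
  ρ-back σ [] a b = begin
    ρ R σ (a ∷ b ∷ [])                   ≈⟨ ρ-front σ a b [] ⟩
    ρ R (pred σ) [] + a * ρ R σ (b ∷ []) ≈⟨ +-congˡ (*-congˡ (ρ-[x] σ b)) ⟩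
    ρ R (pred σ) [] + a * (b * E)        ≈⟨ +-congˡ (solve 3 (λ a b E → a :* (b :* E) := b :* (a :* E))
                                                             refl a b E) ⟩
    ρ R (pred σ) [] + b * (a * E)        ≈⟨ +-congˡ (*-congˡ (ρ-[x] σ a)) ⟨
    ρ R (pred σ) [] + b * ρ R σ (a ∷ []) ∎
    where
    E = ρ R σ []
  ρ-back σ (w ∷ []) a b = begin
    ρ R σ (w ∷ a ∷ b ∷ [])
      ≈⟨ ρ-front σ w a (b ∷ []) ⟩
    ρ R (pred σ) (b ∷ []) + w * ρ R σ (a ∷ b ∷ [])
      ≈⟨ +-cong (ρ-[x] (pred σ) b) (*-congˡ (ρ-back σ [] a b)) ⟩
    b * D + w * (D + b * C)
      ≈⟨ solve 4 (λ b w D C → b :* D :+ w :* (D :+ b :* C) := w :* D :+ b :* (D :+ w :* C)) refl b w D C ⟩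
    w * D + b * (D + w * C)
      ≈⟨ +-cong (ρ-[x] (pred σ) w) (*-congˡ (ρ-front σ w a [])) ⟨
    ρ R (pred σ) (w ∷ []) + b * ρ R σ (w ∷ a ∷ []) ∎
    where
    D = ρ R (pred σ) []
    C = ρ R σ (a ∷ [])
  ρ-back σ (w ∷ w′ ∷ ws) a b = begin
    ρ R σ (w ∷ w′ ∷ ws ++ a ∷ b ∷ [])
      ≈⟨ ρ-front σ w w′ (ws ++ a ∷ b ∷ []) ⟩
    ρ R (pred σ) (ws ++ a ∷ b ∷ []) + w * ρ R σ (w′ ∷ ws ++ a ∷ b ∷ [])
      ≈⟨ +-cong (ρ-back (pred σ) ws a b) (*-congˡ (ρ-back σ (w′ ∷ ws) a b)) ⟩
    (A + b * B) + w * (C + b * D)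
      ≈⟨ solve 6 (λ A B C D b w → (A :+ b :* B) :+ w :* (C :+ b :* D) := (A :+ w :* C) :+ b :* (B :+ w :* D))
                 refl A B C D b w ⟩
    (A + w * C) + b * (B + w * D)
      ≈⟨ +-cong (ρ-front (pred σ) w w′ ws) (*-congˡ (ρ-front σ w w′ (ws ++ a ∷ []))) ⟨
    ρ R (pred σ) (w ∷ w′ ∷ ws) + b * ρ R σ (w ∷ w′ ∷ ws ++ a ∷ []) ∎
    where
    A = ρ R (pred (pred σ)) ws
    B = ρ R (pred σ) (ws ++ a ∷ [])
    C = ρ R (pred σ) (w′ ∷ ws)
    D = ρ R σ (w′ ∷ ws ++ a ∷ [])

  ρ-back-⊖ : ∀ m n ws a b →
    ρ R (suc m ⊖ n) (ws ++ a ∷ b ∷ []) ≈ ρ R (m ⊖ n) ws + b * ρ R (suc m ⊖ n) (ws ++ a ∷ [])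
  ρ-back-⊖ m n ws a b =
    trans (ρ-back (suc m ⊖ n) ws a b) (+-congʳ (reflexive (cong (λ σ → ρ R σ ws) (pred[1+m⊖n]≡m⊖n m n))))

  ρ-back-⊖′ : ∀ m n ws a b c →
    ρ R (suc m ⊖ n) ((ws ++ a ∷ b ∷ []) ++ c ∷ [])
      ≈ ρ R (m ⊖ n) (ws ++ a ∷ []) + c * ρ R (suc m ⊖ n) (ws ++ a ∷ b ∷ [])
  ρ-back-⊖′ m n ws a b c = begin
    ρ R (suc m ⊖ n) ((ws ++ a ∷ b ∷ []) ++ c ∷ [])
      ≡⟨ cong (ρ R (suc m ⊖ n)) (++-assoc ws (a ∷ b ∷ []) (c ∷ [])) ⟩
    ρ R (suc m ⊖ n) (ws ++ a ∷ b ∷ c ∷ [])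
      ≡⟨ cong (ρ R (suc m ⊖ n)) (++-assoc ws (a ∷ []) (b ∷ c ∷ [])) ⟨
    ρ R (suc m ⊖ n) ((ws ++ a ∷ []) ++ b ∷ c ∷ [])
      ≈⟨ ρ-back-⊖ m n (ws ++ a ∷ []) b c ⟩
    ρ R (m ⊖ n) (ws ++ a ∷ []) + c * ρ R (suc m ⊖ n) ((ws ++ a ∷ []) ++ b ∷ [])
      ≡⟨ cong (λ zs → ρ R (m ⊖ n) (ws ++ a ∷ []) + c * ρ R (suc m ⊖ n) zs) (++-assoc ws (a ∷ []) (b ∷ [])) ⟩
    ρ R (m ⊖ n) (ws ++ a ∷ []) + c * ρ R (suc m ⊖ n) (ws ++ a ∷ b ∷ []) ∎

  m<n⇒ρ[m⊖n]≈0 : ∀ {m n} ws → m < n → ρ R (m ⊖ n) ws ≈ 0#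
  m<n⇒ρ[m⊖n]≈0 {zero}  {suc n} ws _         = refl
  m<n⇒ρ[m⊖n]≈0 {suc m} {suc n} ws (s≤s m<n) rewrite [1+m]⊖[1+n]≡m⊖n m n = m<n⇒ρ[m⊖n]≈0 ws m<n

  length<s+s⇒ρ≈0 : ∀ s ws → length ws < s N.+ s → ρ R (+ s) ws ≈ 0#
  length<s+s⇒ρ≈0 zero    ws           ()
  length<s+s⇒ρ≈0 (suc s) []           _ = refl
  length<s+s⇒ρ≈0 (suc s) (a ∷ [])     _ = refl
  length<s+s⇒ρ≈0 (suc s) (a ∷ b ∷ ws) h =
    trans (ρ-front (+ suc s) a b ws)
          (x≈0∧y≈0⇒x+z*y≈0 a (length<s+s⇒ρ≈0 s ws ∣ws∣<s+s)
                              (length<s+s⇒ρ≈0 (suc s) (b ∷ ws) (ℕₚ.≤-trans (ℕₚ.n≤1+n _) h)))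
    where
    ∣ws∣<s+s : length ws < s N.+ s
    ∣ws∣<s+s = s≤s⁻¹ (ℕₚ.≤-trans (s≤s⁻¹ h) (ℕₚ.≤-reflexive (ℕₚ.+-suc s s)))

  length≡s+s⇒ρ≈1 : ∀ s ws → length ws ≡ s N.+ s → ρ R (+ s) ws ≈ 1#
  length≡s+s⇒ρ≈1 zero    []           _ = +-identityʳ 1#
  length≡s+s⇒ρ≈1 (suc s) (a ∷ [])     h = ⊥-elim (ℕₚ.0≢1+n (≡.trans (ℕₚ.suc-injective h) (ℕₚ.+-suc s s)))
  length≡s+s⇒ρ≈1 (suc s) (a ∷ b ∷ ws) h = begin
    ρ R (+ suc s) (a ∷ b ∷ ws)                ≈⟨ ρ-front (+ suc s) a b ws ⟩
    ρ R (+ s) ws + a * ρ R (+ suc s) (b ∷ ws) ≈⟨ +-cong (length≡s+s⇒ρ≈1 s ws ∣ws∣≡s+s)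
                                                        (*-congˡ (length<s+s⇒ρ≈0 (suc s) (b ∷ ws) ∣b∷ws∣<)) ⟩
    1# + a * 0#                               ≈⟨ solve 1 (λ a → con 1 :+ a :* con 0 := con 1) refl a ⟩
    1#                                        ∎
    where
    ∣b∷ws∣≡1+s+s : suc (length ws) ≡ suc (s N.+ s)
    ∣b∷ws∣≡1+s+s = ≡.trans (ℕₚ.suc-injective h) (ℕₚ.+-suc s s)

    ∣ws∣≡s+s : length ws ≡ s N.+ s
    ∣ws∣≡s+s = ℕₚ.suc-injective ∣b∷ws∣≡1+s+s

    ∣b∷ws∣< : suc (length ws) < suc s N.+ suc s
    ∣b∷ws∣< = s≤s (ℕₚ.≤-reflexive (≡.trans ∣b∷ws∣≡1+s+s (≡.sym (ℕₚ.+-suc s s))))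

module _ {c ℓ : Level} (F : CommutativeRing c ℓ) {k : ℕ} {a b : Vect F k} (a~b : Adj F a b) where
  open CommutativeRing F

  adj-mod01 : ∀ {n n′} → n ≡ 2 N.+ n′ → n ≤ k → n % 4 ≡ 0 ⊎ n % 4 ≡ 1 →
    at F a n + at F b n ≈ at F a 0 * at F b n′
  adj-mod01 ≡.refl n≤k n%4 = proj₂ (a~b _ (s≤s (s≤s z≤n)) n≤k) n%4

  adj-mod23 : ∀ {n n′} → n ≡ 2 N.+ n′ → n ≤ k → n % 4 ≡ 2 ⊎ n % 4 ≡ 3 →
    at F a n + at F b n ≈ at F b 0 * at F a n′
  adj-mod23 ≡.refl n≤k n%4 = proj₁ (a~b _ (s≤s (s≤s z≤n)) n≤k) n%4

module WalkRecurrences {c ℓ : Level} (F : CommutativeRing c ℓ) {k m : ℕ} {l r : ℕ → Vect F k}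
                       (walk : BacktracklessWalk F k m l r) where
  open CommutativeRing F
  open BacktracklessWalk walk
  open RingLemmas F
  open import Algebra.Properties.Group +-group using (x≈z//y)
  open import Algebra.Properties.Ring ring using (x[y-z]≈xy-xz; [y-z]x≈yx-zx)
  open import Relation.Binary.Reasoning.Setoid setoid

  x y u v : ℕ → Carrier
  x t = at F (l t) 0
  y t = at F (r t) 0
  u t = x (suc t) - x t
  v t = y (suc t) - y t

  x-step : ∀ t → x (suc t) ≈ x t + u t
  x-step t = sym (x+[y-x]≈y (x t) (x (suc t)))

  y-step : ∀ t → y (suc t) ≈ y t + v t
  y-step t = sym (x+[y-x]≈y (y t) (y (suc t)))

  l-via-r : ∀ {t} → 1 ≤ t → 2 N.* t ≤ m → ∀ {n n′} → n ≡ 2 N.+ n′ → n ≤ k → n % 4 ≡ 2 ⊎ n % 4 ≡ 3 →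
    at F (l t) n ≈ y t * at F (l t) n′ - at F (r t) n
  l-via-r 1≤t 2t≤m n≡ n≤k n%4 = x≈z//y _ _ _ (adj-mod23 F (adj-lr _ 1≤t 2t≤m) n≡ n≤k n%4)

  module Step {t} (1≤t : 1 ≤ t) (2[1+t]≤m : 2 N.* suc t ≤ m) where
    private
      2t≤m : 2 N.* t ≤ m
      2t≤m = ℕₚ.≤-trans (ℕₚ.*-monoʳ-≤ 2 (ℕₚ.n≤1+n t)) 2[1+t]≤m

      2t+1≤m : 2 N.* t N.+ 1 ≤ m
      2t+1≤m = ℕₚ.≤-trans (ℕₚ.n≤1+n _) (ℕₚ.≤-trans (ℕₚ.≤-reflexive (≡.sym (2[1+t]≡1+[2t+1] t))) 2[1+t]≤m)

      lᵗ~rᵗ : Adj F (l t) (r t)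
      lᵗ~rᵗ = adj-lr t 1≤t 2t≤m

      lᵗ⁺¹~rᵗ : Adj F (l (suc t)) (r t)
      lᵗ⁺¹~rᵗ = adj-rl t 1≤t 2t+1≤m

      lᵗ⁺¹~rᵗ⁺¹ : Adj F (l (suc t)) (r (suc t))
      lᵗ⁺¹~rᵗ⁺¹ = adj-lr (suc t) (s≤s z≤n) 2[1+t]≤m

    l-step : ∀ {n n′} → n ≡ 2 N.+ n′ → n ≤ k → n % 4 ≡ 0 ⊎ n % 4 ≡ 1 →
      at F (l (suc t)) n ≈ at F (l t) n + u t * at F (r t) n′
    l-step n≡ n≤k n%4 =
      trans (x+z≈p∧y+z≈p′⇒y≈x+[p′-p] (adj-mod01 F lᵗ~rᵗ n≡ n≤k n%4) (adj-mod01 F lᵗ⁺¹~rᵗ n≡ n≤k n%4))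
            (+-congˡ (sym ([y-z]x≈yx-zx _ (x (suc t)) (x t))))

    r-step : ∀ {n n′} → n ≡ 2 N.+ n′ → n ≤ k → n % 4 ≡ 2 ⊎ n % 4 ≡ 3 →
      at F (r (suc t)) n ≈ at F (r t) n + v t * at F (l (suc t)) n′
    r-step n≡ n≤k n%4 =
      trans (x+z≈p∧y+z≈p′⇒y≈x+[p′-p] (trans (+-comm _ _) (adj-mod23 F lᵗ⁺¹~rᵗ n≡ n≤k n%4))
                                      (trans (+-comm _ _) (adj-mod23 F lᵗ⁺¹~rᵗ⁺¹ n≡ n≤k n%4)))
            (+-congˡ (sym ([y-z]x≈yx-zx _ (y (suc t)) (y t))))

    l₁-step : 2 ≤ k → at F (l (suc t)) 1 ≈ at F (l t) 1 + u t * y t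
    l₁-step 2≤k = begin
      at F (l (suc t)) 1
        ≈⟨ l∈L (suc t) (s≤s z≤n) (ℕₚ.≤-trans 2[1+t]≤m (ℕₚ.n≤1+n m)) ⟩
      at F (l (suc t)) 2
        ≈⟨ x+z≈p∧y+z≈p′⇒y≈x+[p′-p] (adj-mod23 F lᵗ~rᵗ ≡.refl 2≤k (inj₁ ≡.refl))
                                   (adj-mod23 F lᵗ⁺¹~rᵗ ≡.refl 2≤k (inj₁ ≡.refl)) ⟩
      at F (l t) 2 + (y t * x (suc t) - y t * x t)
        ≈⟨ +-cong (sym (l∈L t 1≤t (ℕₚ.≤-trans 2t≤m (ℕₚ.n≤1+n m))))
                  (trans (sym (x[y-z]≈xy-xz (y t) (x (suc t)) (x t))) (*-comm (y t) (u t))) ⟩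
      at F (l t) 1 + u t * y t ∎

    l₄₍ⱼ₊₁₎-step : ∀ j → 4 N.* suc j ≤ k →
      at F (l (suc t)) (4 N.* suc j) ≈ at F (l t) (4 N.* suc j) + u t * at F (r t) (4 N.* j N.+ 2)
    l₄₍ⱼ₊₁₎-step j hk = l-step (4[1+j]≡2+[4j+2] j) hk (inj₁ (4j%4≡0 (suc j)))

    l₄₍ⱼ₊₁₎₊₁-step : ∀ j → 4 N.* suc j N.+ 1 ≤ k →
      at F (l (suc t)) (4 N.* suc j N.+ 1) ≈ at F (l t) (4 N.* suc j N.+ 1) + u t * at F (r t) (4 N.* j N.+ 3)
    l₄₍ⱼ₊₁₎₊₁-step j hk = l-step (4[1+j]+1≡2+[4j+3] j) hk (inj₂ ([4j+r]%4≡r%4 (suc j) 1))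

    r₄ⱼ₊₂-step : ∀ j → 4 N.* j N.+ 2 ≤ k →
      at F (r (suc t)) (4 N.* j N.+ 2) ≈ at F (r t) (4 N.* j N.+ 2) + v t * at F (l (suc t)) (4 N.* j)
    r₄ⱼ₊₂-step j hk = r-step (4j+2≡2+4j j) hk (inj₁ ([4j+r]%4≡r%4 j 2))

    r₄ⱼ₊₃-step : ∀ j → 4 N.* j N.+ 3 ≤ k →
      at F (r (suc t)) (4 N.* j N.+ 3) ≈ at F (r t) (4 N.* j N.+ 3) + v t * at F (l (suc t)) (4 N.* j N.+ 1)
    r₄ⱼ₊₃-step j hk = r-step (4j+3≡2+[4j+1] j) hk (inj₂ ([4j+r]%4≡r%4 j 3))

module _ {c ℓ : Level} (F : CommutativeRing c ℓ) where
  open CommutativeRing F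

  at-≈0 : ∀ {k} (w : Vect F k) → (∀ j → w j ≈ 0#) → ∀ n → at F w n ≈ 0#
  at-≈0 {k} w w≈0 n with n N.<? suc k
  ... | yes _ = w≈0 _
  ... | no  _ = refl

  private
    n+n+2≡1+n+1+n : ∀ n → n N.+ n N.+ 2 ≡ suc n N.+ suc n
    n+n+2≡1+n+1+n = solve-∀

  length-uvSeq : ∀ f g n → length (uvSeq F f g n) ≡ n N.+ n
  length-uvSeq f g zero    = ≡.refl
  length-uvSeq f g (suc n) =
    ≡.trans (length-++ (uvSeq F f g n)) (≡.trans (cong (N._+ 2) (length-uvSeq f g n)) (n+n+2≡1+n+1+n n))

  length-vuSeq : ∀ f g n → length (vuSeq F f g n) ≡ n N.+ n
  length-vuSeq f g zero    = ≡.refl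
  length-vuSeq f g (suc n) =
    ≡.trans (length-++ (vuSeq F f g n)) (≡.trans (cong (N._+ 2) (length-vuSeq f g n)) (n+n+2≡1+n+1+n n))

  module ClosedForms {k m : ℕ} (2≤k : 2 ≤ k) {l r : ℕ → Vect F k} (walk : BacktracklessWalk F k m l r)
                     (l¹≈0 : ∀ j → l 1 j ≈ 0#) (r¹≈0 : ∀ j → r 1 j ≈ 0#) where
    open RingLemmas F
    open DeletionSums F
    open WalkRecurrences F walk
    open import Relation.Binary.Reasoning.Setoid setoid
    open import Algebra.Solver.Ring.NaturalCoefficients.Default commutativeSemiring

    uvu vuv : ℕ → List Carrier
    uvu n = uvSeq F u v n ++ u (suc n) ∷ []
    vuv n = vuSeq F u v n ++ v (suc n) ∷ []

    -- The vertices [l⁽ⁿ⁺²⁾], ⟨r⁽ⁿ⁺²⁾⟩, i.e. i = n + 1 in the theorem; the r-coordinates are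
    -- the ρ-terms subtracted there.
    record ClosedForm (n : ℕ) : Set ℓ where
      field
        l₄ⱼ   : ∀ j → 4 N.* j ≤ k →
          at F (l (2 N.+ n)) (4 N.* j) ≈ ρ F (suc n ⊖ (j N.+ 1)) (uvu n)
        l₄ⱼ₊₁ : ∀ j → 4 N.* j N.+ 1 ≤ k →
          at F (l (2 N.+ n)) (4 N.* j N.+ 1) ≈ ρ F (suc n ⊖ (j N.+ 2)) (vuSeq F u v n)
        r₄ⱼ₊₂ : ∀ j → 4 N.* j N.+ 2 ≤ k →
          at F (r (2 N.+ n)) (4 N.* j N.+ 2) ≈ ρ F (suc n ⊖ (j N.+ 1)) (uvSeq F u v (suc n))
        r₄ⱼ₊₃ : ∀ j → 4 N.* j N.+ 3 ≤ k →
          at F (r (2 N.+ n)) (4 N.* j N.+ 3) ≈ ρ F (suc n ⊖ (j N.+ 2)) (vuv n)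

    y-as-ρ : ∀ n → ρ F (+ n) (vuv n) ≈ y (2 N.+ n)
    y-as-ρ zero = begin
      v 1 * 1# + 0#   ≈⟨ solve 1 (λ w → w :* con 1 :+ con 0 := con 0 :+ w) refl (v 1) ⟩
      0# + v 1        ≈⟨ +-congʳ (at-≈0 (r 1) r¹≈0 0) ⟨
      y 1 + v 1       ≈⟨ y-step 1 ⟨
      y 2             ∎
    y-as-ρ (suc n) = begin
      ρ F (+ suc n) (vuv (suc n))
        ≈⟨ ρ-back-⊖′ n 0 (vuSeq F u v n) (v (suc n)) (u (2 N.+ n)) (v (2 N.+ n)) ⟩
      ρ F (+ n) (vuv n) + v (2 N.+ n) * ρ F (+ suc n) (vuSeq F u v (suc n))
        ≈⟨ +-cong (y-as-ρ n) (*-congˡ (length≡s+s⇒ρ≈1 (suc n) (vuSeq F u v (suc n)) (length-vuSeq u v (suc n)))) ⟩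
      y (2 N.+ n) + v (2 N.+ n) * 1#
        ≈⟨ +-congˡ (*-identityʳ _) ⟩
      y (2 N.+ n) + v (2 N.+ n)
        ≈⟨ y-step (2 N.+ n) ⟨
      y (3 N.+ n) ∎

    closedForm-base : 2 N.* 2 ≤ m → ClosedForm 0
    closedForm-base 4≤m =
      record { l₄ⱼ = l₄ⱼ ; l₄ⱼ₊₁ = l₄ⱼ₊₁ ; r₄ⱼ₊₂ = r₄ⱼ₊₂ ; r₄ⱼ₊₃ = r₄ⱼ₊₃ }
      where
      open Step {1} (s≤s z≤n) 4≤m

      l¹ₙ≈0 : ∀ n → at F (l 1) n ≈ 0#
      l¹ₙ≈0 = at-≈0 (l 1) l¹≈0

      r¹ₙ≈0 : ∀ n → at F (r 1) n ≈ 0#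
      r¹ₙ≈0 = at-≈0 (r 1) r¹≈0

      l₄ⱼ : ∀ j → 4 N.* j ≤ k → at F (l 2) (4 N.* j) ≈ ρ F (1 ⊖ (j N.+ 1)) (uvu 0)
      l₄ⱼ zero    _  = begin
        x 2             ≈⟨ x-step 1 ⟩
        x 1 + u 1       ≈⟨ +-congʳ (l¹ₙ≈0 0) ⟩
        0# + u 1        ≈⟨ solve 1 (λ w → con 0 :+ w := w :* con 1 :+ con 0) refl (u 1) ⟩
        u 1 * 1# + 0#   ∎
      l₄ⱼ (suc j) hk = begin
        at F (l 2) (4 N.* suc j)
          ≈⟨ l₄₍ⱼ₊₁₎-step j hk ⟩
        at F (l 1) (4 N.* suc j) + u 1 * at F (r 1) (4 N.* j N.+ 2)
          ≈⟨ x≈0∧y≈0⇒x+z*y≈0 (u 1) (l¹ₙ≈0 (4 N.* suc j)) (r¹ₙ≈0 (4 N.* j N.+ 2)) ⟩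
        0#
          ≈⟨ m<n⇒ρ[m⊖n]≈0 (uvu 0) (s≤s (ℕₚ.m≤n+m 1 j)) ⟨
        ρ F (1 ⊖ (suc j N.+ 1)) (uvu 0) ∎

      l₄ⱼ₊₁ : ∀ j → 4 N.* j N.+ 1 ≤ k → at F (l 2) (4 N.* j N.+ 1) ≈ ρ F (1 ⊖ (j N.+ 2)) []
      l₄ⱼ₊₁ zero    _  = trans (l₁-step 2≤k) (x≈0∧y≈0⇒x+z*y≈0 (u 1) (l¹ₙ≈0 1) (r¹ₙ≈0 0))
      l₄ⱼ₊₁ (suc j) hk = begin
        at F (l 2) (4 N.* suc j N.+ 1)
          ≈⟨ l₄₍ⱼ₊₁₎₊₁-step j hk ⟩
        at F (l 1) (4 N.* suc j N.+ 1) + u 1 * at F (r 1) (4 N.* j N.+ 3)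
          ≈⟨ x≈0∧y≈0⇒x+z*y≈0 (u 1) (l¹ₙ≈0 (4 N.* suc j N.+ 1)) (r¹ₙ≈0 (4 N.* j N.+ 3)) ⟩
        0#
          ≈⟨ m<n⇒ρ[m⊖n]≈0 [] (ℕₚ.m≤n+m 2 (suc j)) ⟨
        ρ F (1 ⊖ (suc j N.+ 2)) [] ∎

      r₄ⱼ₊₂ : ∀ j → 4 N.* j N.+ 2 ≤ k → at F (r 2) (4 N.* j N.+ 2) ≈ ρ F (1 ⊖ (j N.+ 1)) (uvSeq F u v 1)
      r₄ⱼ₊₂ j hk = same-recurrence (v 1) (r₄ⱼ₊₂-step j hk)
        (trans (r¹ₙ≈0 (4 N.* j N.+ 2)) (sym (m<n⇒ρ[m⊖n]≈0 [] (ℕₚ.m≤n+m 1 j))))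
        (l₄ⱼ j (n≡2+n′⇒n≤k⇒n′≤k (4j+2≡2+4j j) hk))
        (ρ-back-⊖ 0 (j N.+ 1) [] (u 1) (v 1))

      r₄ⱼ₊₃ : ∀ j → 4 N.* j N.+ 3 ≤ k → at F (r 2) (4 N.* j N.+ 3) ≈ ρ F (1 ⊖ (j N.+ 2)) (vuv 0)
      r₄ⱼ₊₃ j hk = begin
        at F (r 2) (4 N.* j N.+ 3)
          ≈⟨ r₄ⱼ₊₃-step j hk ⟩
        at F (r 1) (4 N.* j N.+ 3) + v 1 * at F (l 2) (4 N.* j N.+ 1)
          ≈⟨ x≈0∧y≈0⇒x+z*y≈0 (v 1) (r¹ₙ≈0 (4 N.* j N.+ 3))
                             (trans (l₄ⱼ₊₁ j (n≡2+n′⇒n≤k⇒n′≤k (4j+3≡2+[4j+1] j) hk))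
                                    (m<n⇒ρ[m⊖n]≈0 [] 1<j+2)) ⟩
        0#
          ≈⟨ m<n⇒ρ[m⊖n]≈0 (vuv 0) 1<j+2 ⟨
        ρ F (1 ⊖ (j N.+ 2)) (vuv 0) ∎
        where
        1<j+2 : 1 < j N.+ 2
        1<j+2 = ℕₚ.m≤n+m 2 j

    closedForm-step : ∀ n → 2 N.* (3 N.+ n) ≤ m → ClosedForm n → ClosedForm (suc n)
    closedForm-step n 2[3+n]≤m IH =
      record { l₄ⱼ = l₄ⱼ ; l₄ⱼ₊₁ = l₄ⱼ₊₁ ; r₄ⱼ₊₂ = r₄ⱼ₊₂ ; r₄ⱼ₊₃ = r₄ⱼ₊₃ }
      where
      open Step {2 N.+ n} (s≤s z≤n) 2[3+n]≤m
      module IH = ClosedForm IH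

      ρ[1+n⊖j]≈ρ[2+n⊖1+j] : ∀ j ws → ρ F (suc n ⊖ j) ws ≈ ρ F (2 N.+ n ⊖ suc j) ws
      ρ[1+n⊖j]≈ρ[2+n⊖1+j] j ws = reflexive (cong (λ σ → ρ F σ ws) (≡.sym ([1+m]⊖[1+n]≡m⊖n (suc n) j)))

      l₄ⱼ : ∀ j → 4 N.* j ≤ k → at F (l (3 N.+ n)) (4 N.* j) ≈ ρ F (2 N.+ n ⊖ (j N.+ 1)) (uvu (suc n))
      l₄ⱼ zero    _  = same-recurrence (u (2 N.+ n)) (trans (x-step (2 N.+ n)) (+-congˡ (sym (*-identityʳ _))))
        (IH.l₄ⱼ 0 z≤n)
        (sym (length≡s+s⇒ρ≈1 (suc n) (uvSeq F u v (suc n)) (length-uvSeq u v (suc n))))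
        (ρ-back-⊖′ (suc n) 1 (uvSeq F u v n) (u (suc n)) (v (suc n)) (u (2 N.+ n)))
      l₄ⱼ (suc j) hk = same-recurrence (u (2 N.+ n)) (l₄₍ⱼ₊₁₎-step j hk)
        (IH.l₄ⱼ (suc j) hk)
        (trans (IH.r₄ⱼ₊₂ j (n≡2+n′⇒n≤k⇒n′≤k (4[1+j]≡2+[4j+2] j) hk))
               (ρ[1+n⊖j]≈ρ[2+n⊖1+j] (j N.+ 1) (uvSeq F u v (suc n))))
        (ρ-back-⊖′ (suc n) (suc j N.+ 1) (uvSeq F u v n) (u (suc n)) (v (suc n)) (u (2 N.+ n)))

      l₄ⱼ₊₁ : ∀ j → 4 N.* j N.+ 1 ≤ k →
        at F (l (3 N.+ n)) (4 N.* j N.+ 1) ≈ ρ F (2 N.+ n ⊖ (j N.+ 2)) (vuSeq F u v (suc n))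
      l₄ⱼ₊₁ zero    _  = same-recurrence (u (2 N.+ n)) (l₁-step 2≤k)
        (IH.l₄ⱼ₊₁ 0 (ℕₚ.≤-trans (s≤s z≤n) 2≤k))
        (sym (y-as-ρ n))
        (ρ-back-⊖ (suc n) 2 (vuSeq F u v n) (v (suc n)) (u (2 N.+ n)))
      l₄ⱼ₊₁ (suc j) hk = same-recurrence (u (2 N.+ n)) (l₄₍ⱼ₊₁₎₊₁-step j hk)
        (IH.l₄ⱼ₊₁ (suc j) hk)
        (trans (IH.r₄ⱼ₊₃ j (n≡2+n′⇒n≤k⇒n′≤k (4[1+j]+1≡2+[4j+3] j) hk))
               (ρ[1+n⊖j]≈ρ[2+n⊖1+j] (j N.+ 2) (vuv n)))
        (ρ-back-⊖ (suc n) (suc j N.+ 2) (vuSeq F u v n) (v (suc n)) (u (2 N.+ n)))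

      r₄ⱼ₊₂ : ∀ j → 4 N.* j N.+ 2 ≤ k →
        at F (r (3 N.+ n)) (4 N.* j N.+ 2) ≈ ρ F (2 N.+ n ⊖ (j N.+ 1)) (uvSeq F u v (2 N.+ n))
      r₄ⱼ₊₂ j hk = same-recurrence (v (2 N.+ n)) (r₄ⱼ₊₂-step j hk)
        (IH.r₄ⱼ₊₂ j hk)
        (l₄ⱼ j (n≡2+n′⇒n≤k⇒n′≤k (4j+2≡2+4j j) hk))
        (ρ-back-⊖ (suc n) (j N.+ 1) (uvSeq F u v (suc n)) (u (2 N.+ n)) (v (2 N.+ n)))

      r₄ⱼ₊₃ : ∀ j → 4 N.* j N.+ 3 ≤ k →
        at F (r (3 N.+ n)) (4 N.* j N.+ 3) ≈ ρ F (2 N.+ n ⊖ (j N.+ 2)) (vuv (suc n))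
      r₄ⱼ₊₃ j hk = same-recurrence (v (2 N.+ n)) (r₄ⱼ₊₃-step j hk)
        (IH.r₄ⱼ₊₃ j hk)
        (l₄ⱼ₊₁ j (n≡2+n′⇒n≤k⇒n′≤k (4j+3≡2+[4j+1] j) hk))
        (ρ-back-⊖′ (suc n) (j N.+ 2) (vuSeq F u v n) (v (suc n)) (u (2 N.+ n)) (v (2 N.+ n)))

    closedForm : ∀ n → 2 N.* (2 N.+ n) ≤ m → ClosedForm n
    closedForm zero    4≤m      = closedForm-base 4≤m
    closedForm (suc n) 2[3+n]≤m =
      closedForm-step n 2[3+n]≤m (closedForm n (ℕₚ.≤-trans (ℕₚ.*-monoʳ-≤ 2 (ℕₚ.n≤1+n (2 N.+ n))) 2[3+n]≤m))

theorem1 : ∀ {c ℓ : Level} (F : CommutativeRing c ℓ) (q : ℕ) → IsPrimePower q → IsFieldOfOrder F q →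
  let open CommutativeRing F in
  (k : ℕ) → 2 ≤ k → (m : ℕ) → (l r : ℕ → Vect F k) →
  BacktracklessWalk F k m l r →
  (∀ j → l 1 j ≈ 0#) → (∀ j → r 1 j ≈ 0#) →
  let x = λ (t : ℕ) → at F (l t) 0
      y = λ (t : ℕ) → at F (r t) 0
      u = λ (t : ℕ) → x (suc t) - x t
      v = λ (t : ℕ) → y (suc t) - y t
  in (i : ℕ) → 1 ≤ i → 2 N.* suc i ≤ m → (j : ℕ) →
    ((4 N.* j ≤ k →
        at F (l (suc i)) (4 N.* j)
          ≈ ρ F (i ⊖ (j N.+ 1)) (uvSeq F u v (i N.∸ 1) ++ (u i ∷ [])))
   × (4 N.* j N.+ 1 ≤ k →
        at F (l (suc i)) (4 N.* j N.+ 1)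
          ≈ ρ F (i ⊖ (j N.+ 2)) (vuSeq F u v (i N.∸ 1)))
   × (4 N.* j N.+ 2 ≤ k →
        at F (l (suc i)) (4 N.* j N.+ 2)
          ≈ y (suc i) * at F (l (suc i)) (4 N.* j) - ρ F (i ⊖ (j N.+ 1)) (uvSeq F u v i))
   × (4 N.* j N.+ 3 ≤ k →
        at F (l (suc i)) (4 N.* j N.+ 3)
          ≈ y (suc i) * at F (l (suc i)) (4 N.* j N.+ 1)
              - ρ F (i ⊖ (j N.+ 2)) (vuSeq F u v (i N.∸ 1) ++ (v i ∷ []))))
theorem1 F _ _ _ k 2≤k m l r walk l¹≈0 r¹≈0 zero    () _ _
theorem1 F _ _ _ k 2≤k m l r walk l¹≈0 r¹≈0 (suc n) _  2[2+n]≤m j =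
    l₄ⱼ j
  , l₄ⱼ₊₁ j
  , (λ hk → trans (l-via-r (s≤s z≤n) 2[2+n]≤m (4j+2≡2+4j j) hk (inj₁ ([4j+r]%4≡r%4 j 2)))
                  (+-congˡ (-‿cong (r₄ⱼ₊₂ j hk))))
  , (λ hk → trans (l-via-r (s≤s z≤n) 2[2+n]≤m (4j+3≡2+[4j+1] j) hk (inj₂ ([4j+r]%4≡r%4 j 3)))
                  (+-congˡ (-‿cong (r₄ⱼ₊₃ j hk))))
  where
  open CommutativeRing F
  open WalkRecurrences F walk using (l-via-r)
  open ClosedForms F 2≤k walk l¹≈0 r¹≈0 using (closedForm; module ClosedForm)
  open ClosedForm (closedForm n 2[2+n]≤m)
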